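{- Let $G$ be a graph of order $n$. Then $\gamma_{\{R2\}}(G)=3$ if and only if one of the following holds: (i) $\Delta(G)=n-2$ and $N_{n-2}(G)$ is a clique; (ii) $\Delta(G)<n-2$ and $\gamma_2(G)=3$.
   Context: All graphs are finite and simple. A Roman $\{2\}$-dominating function on a graph $G=(V,E)$ is a function $f:V\to\{0,1,2\}$ such that for every vertex $v$ with $f(v)=0$, $\sum_{u\in N(v)}f(u)\geq 2$. Its weight is $\sum_{v\in V}f(v)$, and $\gamma_{\{R2\}}(G)$ is the minimum weight of such a function. $\Delta(G)$ is the maximum degree of $G$. For $i=1,\dots,n-1$, $N_i(G)=\{v\in V:\deg(v)=i\}$. A subset $S\subseteq V$ is a $2$-dominating set if every vertex of $V\setminus S$ has at least two neighbors in $S$; $\gamma_2(G)$ is the minimum cardinality of a $2$-dominating set of $G$. -}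

module Defs where

open import Data.Nat using (ℕ; zero; suc; _+_; _≤_; _<_; _⊔_)
open import Data.Bool using (Bool; true; false; if_then_else_)
open import Data.Fin using (Fin)
open import Data.List using (List; map; foldr; allFin)
open import Data.Nat.ListAction using (sum)
open import Data.Vec using (lookup)
open import Data.Fin.Subset using (Subset; _∈_; _∉_; ∣_∣)
open import Relation.Binary.PropositionalEquality using (_≡_; _≢_)
open import Relation.Nullary using (¬_)
open import Data.Product using (Σ; _×_)

record Graph (n : ℕ) : Set where
  field
    adj     : Fin n → Fin n → Bool
    symm    : ∀ u v → adj u v ≡ adj v u
    irrefl  : ∀ v → adj v v ≡ false
open Graph public

Adj : ∀ {n} → Graph n → Fin n → Fin n → Set
Adj G u v = adj G u v ≡ true

nbSum : ∀ {n} → Graph n → (Fin n → ℕ) → Fin n → ℕ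
nbSum {n} G f v = sum (map (λ u → if adj G v u then f u else 0) (allFin n))

deg : ∀ {n} → Graph n → Fin n → ℕ
deg G v = nbSum G (λ _ → 1) v

-- maximum degree Δ(G) (0 for the empty graph)
Δ : ∀ {n} → Graph n → ℕ
Δ {n} G = foldr _⊔_ 0 (map (deg G) (allFin n))

weight : ∀ {n} → (Fin n → ℕ) → ℕ
weight {n} f = sum (map f (allFin n))

IsR2DF : ∀ {n} → Graph n → (Fin n → ℕ) → Set
IsR2DF {n} G f = (∀ v → f v ≤ 2) × (∀ v → f v ≡ 0 → 2 ≤ nbSum G f v)

R2DomNumberIs : ∀ {n} → Graph n → ℕ → Set
R2DomNumberIs G k =
  Σ _ (λ f → IsR2DF G f × weight f ≡ k) × (∀ f → IsR2DF G f → k ≤ weight f)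

ind : ∀ {n} → Subset n → Fin n → ℕ
ind S v = if lookup S v then 1 else 0

Is2DomSet : ∀ {n} → Graph n → Subset n → Set
Is2DomSet G S = ∀ v → v ∉ S → 2 ≤ nbSum G (ind S) v

TwoDomNumberIs : ∀ {n} → Graph n → ℕ → Set
TwoDomNumberIs G k =
  Σ _ (λ S → Is2DomSet G S × ∣ S ∣ ≡ k) × (∀ S → Is2DomSet G S → k ≤ ∣ S ∣)

-- N_{n-2}(G) is a clique: any two distinct vertices of degree n-2 are adjacent
-- ("deg v = n - 2" written as deg v + 2 ≡ n to avoid truncated subtraction)
DegNminus2Clique : ∀ {n} → Graph n → Set
DegNminus2Clique {n} G =
  ∀ u v → deg G u + 2 ≡ n → deg G v + 2 ≡ n → u ≢ v → Adj G u v

-- Everything rests on one local estimate: if a Roman {2}-dominating function f has total weight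
-- at most 1 outside a vertex v, then a non-neighbour of v with value 0 would have to be dominated
-- by that weight alone, so every non-neighbour of v (v included) has positive value and
-- n ≤ deg v + 2. Hence a function of weight at most 2 forces Δ ≥ n − 2, and when Δ = n − 2 its
-- positive vertices are two non-adjacent vertices of degree n − 2; conversely such a pair, or
-- Δ ≥ n − 1, yields a function of weight 2. Putting 2 on a vertex of maximum degree and 1 on its
-- non-neighbours has weight n − Δ + 1, which is 3 in case (i). In case (ii) the same estimate
-- rules out the value 2 in a function of weight 3, which is therefore the indicator of a
-- 2-dominating set of size 3.

module Submission where

open import Defs
open import Data.Nat using (ℕ; zero; suc; _+_; _≤_; _<_; _⊔_; z≤n; s≤s; z<s; _≡ᵇ_; _≤?_; _≟_)
open import Data.Nat.Properties
open import Data.Fin using (Fin; zero; suc; punchIn; punchOut)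
open import Data.Fin.Properties using (punchInᵢ≢i; punchIn-punchOut; punchOut-injective)
open import Data.Fin.Subset using (Subset; _∈_; _∉_; ∣_∣; ⁅_⁆)
open import Data.Fin.Subset.Properties using (x∈⁅x⁆; ∣⁅x⁆∣≡1)
open import Data.Bool using (true; false; if_then_else_)
open import Data.Vec as Vec using (_∷_; []; lookup)
open import Data.Vec.Properties using (lookup∘tabulate; []=⇒lookup; lookup⇒[]=)
open import Data.Sum using (_⊎_; inj₁; inj₂)
open import Data.Empty using (⊥-elim)
open import Data.List as List using (allFin)
open import Data.List.Properties using (map-tabulate)
open import Data.Vec.Functional as Vector using (Vector; removeAt)
open import Data.Product using (_×_; _,_; ∃; Σ-syntax; proj₁; proj₂)
open import Function.Base using (_∘_; id; case_of_)
open import Relation.Binary.PropositionalEquality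
open import Function.Bundles using (_⇔_; mk⇔)
open import Relation.Nullary using (¬_; contradiction; yes; no)
open import Algebra.Properties.CommutativeMonoid.Sum +-0-commutativeMonoid
  using (sum-remove; ∑-distrib-+; sum-cong-≗) renaming (sum to ∑)

private variable
  n : ℕ

foldr-map-allFin : {A B : Set} (_∙_ : A → B → B) (e : B) (g : Vector A n) →
                   List.foldr _∙_ e (List.map g (allFin n)) ≡ Vector.foldr _∙_ e g
foldr-map-allFin _∙_ e g = trans (cong (List.foldr _∙_ e) (map-tabulate id g)) (foldr-tabulate g)
  where
  foldr-tabulate : ∀ {n} (g : Vector _ n) → List.foldr _∙_ e (List.tabulate g) ≡ Vector.foldr _∙_ e g
  foldr-tabulate {n = zero}  g = refl
  foldr-tabulate {n = suc n} g = cong (g zero ∙_) (foldr-tabulate (g ∘ suc))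

weight≡∑ : (f : Vector ℕ n) → weight f ≡ ∑ f
weight≡∑ = foldr-map-allFin _+_ 0

∑-mono-≤ : {f g : Vector ℕ n} → (∀ i → f i ≤ g i) → ∑ f ≤ ∑ g
∑-mono-≤ {n = zero}  f≤g = z≤n
∑-mono-≤ {n = suc n} f≤g = +-mono-≤ (f≤g zero) (∑-mono-≤ (f≤g ∘ suc))

∑-ones : ∑ {n} (λ _ → 1) ≡ n
∑-ones {n = zero}  = refl
∑-ones {n = suc n} = cong suc ∑-ones

∑-pos : (g : Vector ℕ n) → 0 < ∑ g → ∃ λ i → 0 < g i
∑-pos {n = suc n} g pos with g zero in g₀≡
... | suc _ = zero , subst (0 <_) (sym g₀≡) z<s
... | zero  = let i , gᵢ>0 = ∑-pos (g ∘ suc) pos in suc i , gᵢ>0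

point≤∑ : (g : Vector ℕ n) (i : Fin n) → g i ≤ ∑ g
point≤∑ {n = suc n} g i = subst (g i ≤_) (sym (sum-remove g)) (m≤m+n (g i) _)

∑-two : (g : Vector ℕ n) {i j : Fin n} → i ≢ j → g i + g j ≤ ∑ g
∑-two {n = suc n} g {i} {j} i≢j = subst (g i + g j ≤_) (sym (sum-remove g))
  (+-monoʳ-≤ (g i) (subst (_≤ ∑ (removeAt g i)) (cong g (punchIn-punchOut i≢j))
                                    (point≤∑ (removeAt g i) (punchOut i≢j))))

∑-three : (g : Vector ℕ n) {i j k : Fin n} → i ≢ j → i ≢ k → j ≢ k →
          g i + (g j + g k) ≤ ∑ g
∑-three {n = suc n} g {i} {j} {k} i≢j i≢k j≢k = subst (g i + (g j + g k) ≤_) (sym (sum-remove g))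
  (+-monoʳ-≤ (g i) (subst₂ (λ x y → x + y ≤ ∑ (removeAt g i))
                           (cong g (punchIn-punchOut i≢j)) (cong g (punchIn-punchOut i≢k))
                           (∑-two (removeAt g i) (j≢k ∘ punchOut-injective i≢j i≢k))))

∑-removeAt≤ : (g : Vector ℕ (suc n)) {i : Fin (suc n)} {k m : ℕ} →
              k ≤ g i → ∑ g ≤ k + m → ∑ (removeAt g i) ≤ m
∑-removeAt≤ g {i} {k} {m} k≤gᵢ ∑≤k+m = +-cancelˡ-≤ k _ _
  (≤-trans (+-monoˡ-≤ (∑ (removeAt g i)) k≤gᵢ) (subst (_≤ k + m) (sum-remove g) ∑≤k+m))

foldr-⊔-ub : (g : Vector ℕ n) (i : Fin n) → g i ≤ Vector.foldr _⊔_ 0 g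
foldr-⊔-ub g zero    = m≤m⊔n (g zero) _
foldr-⊔-ub g (suc i) = ≤-trans (foldr-⊔-ub (g ∘ suc) i) (m≤n⊔m (g zero) _)

foldr-⊔-attained : (g : Vector ℕ (suc n)) → ∃ λ i → Vector.foldr _⊔_ 0 g ≡ g i
foldr-⊔-attained {n = zero}  g = zero , ⊔-identityʳ (g zero)
foldr-⊔-attained {n = suc n} g with ⊔-sel (g zero) (Vector.foldr _⊔_ 0 (g ∘ suc))
... | inj₁ max≡g₀ = zero , max≡g₀
... | inj₂ max≡rest = let i , rest≡gᵢ = foldr-⊔-attained (g ∘ suc) in suc i , trans max≡rest rest≡gᵢ

∑-ind : (S : Subset n) → ∑ (ind S) ≡ ∣ S ∣
∑-ind []          = refl
∑-ind (true ∷ S)  = cong suc (∑-ind S)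
∑-ind (false ∷ S) = ∑-ind S

ind≤1 : (S : Subset n) (v : Fin n) → ind S v ≤ 1
ind≤1 S v with lookup S v
... | true  = ≤-refl
... | false = z≤n

ind-∈ : {S : Subset n} {v : Fin n} → v ∈ S → ind S v ≡ 1
ind-∈ v∈S = cong (if_then 1 else 0) ([]=⇒lookup v∈S)

ind-∉ : (S : Subset n) {v : Fin n} → v ∉ S → ind S v ≡ 0
ind-∉ S {v} v∉S with lookup S v in S[v]
... | true  = ⊥-elim (v∉S (lookup⇒[]= v S S[v]))
... | false = refl

support : Vector ℕ n → Subset n
support f = Vec.tabulate (λ i → f i ≡ᵇ 1)

ind-support : (f : Vector ℕ n) → (∀ i → f i ≤ 1) → ∀ i → ind (support f) i ≡ f i
ind-support f f≤1 i = trans (cong (if_then 1 else 0) (lookup∘tabulate _ i)) (bit (f≤1 i))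
  where
  bit : ∀ {k} → k ≤ 1 → (if k ≡ᵇ 1 then 1 else 0) ≡ k
  bit z≤n       = refl
  bit (s≤s z≤n) = refl

module _ {n : ℕ} (G : Graph n) where

  restrictToN : Fin n → Vector ℕ n → Vector ℕ n
  restrictToN u f i = if adj G u i then f i else 0

  nbSum≡∑ : (f : Vector ℕ n) (u : Fin n) → nbSum G f u ≡ ∑ (restrictToN u f)
  nbSum≡∑ f u = foldr-map-allFin _+_ 0 (restrictToN u f)

  restrictToN≤ : (f : Vector ℕ n) (u i : Fin n) → restrictToN u f i ≤ f i
  restrictToN≤ f u i with adj G u i
  ... | true  = ≤-refl
  ... | false = z≤n

  nbSum≤∑ : (f : Vector ℕ n) (u : Fin n) → nbSum G f u ≤ ∑ f
  nbSum≤∑ f u = subst (_≤ ∑ f) (sym (nbSum≡∑ f u)) (∑-mono-≤ (restrictToN≤ f u))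

  restrictToN-adj : (f : Vector ℕ n) {u i : Fin n} → Adj G u i → restrictToN u f i ≡ f i
  restrictToN-adj f {i = i} u~i = cong (if_then f i else 0) u~i

  adj₂⇒≤nbSum : (f : Vector ℕ n) {u v w : Fin n} → Adj G u v → Adj G u w → v ≢ w →
                f v + f w ≤ nbSum G f u
  adj₂⇒≤nbSum f {u} u~v u~w v≢w = subst₂ _≤_
    (cong₂ _+_ (restrictToN-adj f u~v) (restrictToN-adj f u~w)) (sym (nbSum≡∑ f u))
    (∑-two (restrictToN u f) v≢w)

  adj⇒≤nbSum : (f : Vector ℕ n) {u v : Fin n} → Adj G u v → f v ≤ nbSum G f u
  adj⇒≤nbSum f {u} u~v = subst₂ _≤_ (restrictToN-adj f u~v) (sym (nbSum≡∑ f u))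
    (point≤∑ (restrictToN u f) _)

  nonAdj : Fin n → Vector ℕ n
  nonAdj v u = if adj G v u then 0 else 1

  nonAdj-self : (v : Fin n) → nonAdj v v ≡ 1
  nonAdj-self v = cong (if_then 0 else 1) (irrefl G v)

  nonAdj≤1 : (v u : Fin n) → nonAdj v u ≤ 1
  nonAdj≤1 v u with adj G v u
  ... | true  = z≤n
  ... | false = ≤-refl

  nonAdj≡0⇒adj : {v u : Fin n} → nonAdj v u ≡ 0 → Adj G v u
  nonAdj≡0⇒adj {v} {u} v≁u≡0 with adj G v u
  ... | true = refl

  nonAdj>0⇒¬adj : {v u : Fin n} → 0 < nonAdj v u → adj G v u ≡ false
  nonAdj>0⇒¬adj {v} {u} v≁u>0 with adj G v u
  ... | false = refl

  ¬adj⇒nonAdj≡1 : {v u : Fin n} → adj G v u ≡ false → nonAdj v u ≡ 1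
  ¬adj⇒nonAdj≡1 = cong (if_then 0 else 1)

  deg+∑nonAdj : (v : Fin n) → deg G v + ∑ (nonAdj v) ≡ n
  deg+∑nonAdj v = begin
    deg G v + ∑ (nonAdj v)                      ≡⟨ cong (_+ ∑ (nonAdj v)) (nbSum≡∑ (λ _ → 1) v) ⟩
    ∑ (restrictToN v (λ _ → 1)) + ∑ (nonAdj v)  ≡⟨ ∑-distrib-+ (restrictToN v (λ _ → 1)) (nonAdj v) ⟨
    ∑ (λ u → restrictToN v (λ _ → 1) u + nonAdj v u) ≡⟨ sum-cong-≗ (λ u → partition (adj G v u)) ⟩
    ∑ {n} (λ _ → 1)                             ≡⟨ ∑-ones ⟩
    n                                           ∎
    where
    open ≡-Reasoning
    partition : ∀ b → (if b then 1 else 0) + (if b then 0 else 1) ≡ 1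
    partition true  = refl
    partition false = refl

  deg≤Δ : (v : Fin n) → deg G v ≤ Δ G
  deg≤Δ v = subst (deg G v ≤_) (sym (foldr-map-allFin _⊔_ 0 (deg G))) (foldr-⊔-ub (deg G) v)

  LightR2DF : Set
  LightR2DF = Σ[ f ∈ Vector ℕ n ] IsR2DF G f × ∑ f ≤ 2

  star : Fin n → Vector ℕ n
  star v u = nonAdj v u + ind ⁅ v ⁆ u

  star-R2DF : (v : Fin n) → IsR2DF G (star v)
  star-R2DF v = (λ u → +-mono-≤ (nonAdj≤1 v u) (ind≤1 ⁅ v ⁆ u)) , dominated
    where
    star-v≡2 : star v v ≡ 2
    star-v≡2 = cong₂ _+_ (nonAdj-self v) (ind-∈ (x∈⁅x⁆ v))
    dominated : ∀ u → star v u ≡ 0 → 2 ≤ nbSum G (star v) u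
    dominated u star-u≡0 = subst (_≤ nbSum G (star v) u) star-v≡2
      (adj⇒≤nbSum (star v) (trans (symm G u v) (nonAdj≡0⇒adj (m+n≡0⇒m≡0 _ star-u≡0))))

  deg+∑star : (v : Fin n) → deg G v + ∑ (star v) ≡ suc n
  deg+∑star v = begin
    deg G v + ∑ (star v)                        ≡⟨ cong (deg G v +_) (∑-distrib-+ (nonAdj v) (ind ⁅ v ⁆)) ⟩
    deg G v + (∑ (nonAdj v) + ∑ (ind ⁅ v ⁆))    ≡⟨ +-assoc (deg G v) _ _ ⟨
    deg G v + ∑ (nonAdj v) + ∑ (ind ⁅ v ⁆)      ≡⟨ cong₂ _+_ (deg+∑nonAdj v) (trans (∑-ind ⁅ v ⁆) (∣⁅x⁆∣≡1 v)) ⟩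
    n + 1                                       ≡⟨ +-comm n 1 ⟩
    suc n                                       ∎
    where open ≡-Reasoning

  ∑nonAdj≡2 : {v : Fin n} → deg G v + 2 ≡ n → ∑ (nonAdj v) ≡ 2
  ∑nonAdj≡2 {v} deg+2≡n = +-cancelˡ-≡ (deg G v) _ _ (trans (deg+∑nonAdj v) (sym deg+2≡n))

  unique-nonNeighbour : {v u w : Fin n} → deg G v + 2 ≡ n → adj G v u ≡ false → v ≢ u →
                        w ≢ v → w ≢ u → Adj G v w
  unique-nonNeighbour {v} {u} {w} deg+2≡n v≁u v≢u w≢v w≢u =
    nonAdj≡0⇒adj (n≤0⇒n≡0 (+-cancelˡ-≤ 2 (nonAdj v w) 0 2+nonAdj≤2))
    where
    2+nonAdj≤2 : 1 + (1 + nonAdj v w) ≤ 2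
    2+nonAdj≤2 = subst₂ (λ x y → x + (y + nonAdj v w) ≤ 2) (nonAdj-self v) (¬adj⇒nonAdj≡1 v≁u)
      (subst (nonAdj v v + (nonAdj v u + nonAdj v w) ≤_) (∑nonAdj≡2 deg+2≡n)
        (∑-three (nonAdj v) v≢u (w≢v ∘ sym) (w≢u ∘ sym)))

  nonAdjacentPair⇒light : {u v : Fin n} → deg G u + 2 ≡ n → deg G v + 2 ≡ n → u ≢ v →
                          adj G u v ≡ false → LightR2DF
  nonAdjacentPair⇒light {u} {v} deg-u deg-v u≢v u≁v =
    nonAdj u , ((m≤n⇒m≤1+n ∘ nonAdj≤1 u) , dominated) , ≤-reflexive (∑nonAdj≡2 deg-u)
    where
    dominated : ∀ w → nonAdj u w ≡ 0 → 2 ≤ nbSum G (nonAdj u) w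
    dominated w u≁w≡0 = subst (_≤ nbSum G (nonAdj u) w)
      (cong₂ _+_ (nonAdj-self u) (¬adj⇒nonAdj≡1 u≁v))
      (adj₂⇒≤nbSum (nonAdj u) (trans (symm G w u) u~w) (trans (symm G w v) v~w) u≢v)
      where
      u~w : Adj G u w
      u~w = nonAdj≡0⇒adj u≁w≡0
      w≢u : w ≢ u
      w≢u refl = case (trans (sym u~w) (irrefl G w)) of λ ()
      w≢v : w ≢ v
      w≢v refl = case (trans (sym u~w) u≁v) of λ ()
      v~w : Adj G v w
      v~w = unique-nonNeighbour deg-v (trans (symm G v u) u≁v) (u≢v ∘ sym) w≢v w≢u

  nbSum-cong : {f g : Vector ℕ n} → (∀ i → f i ≡ g i) → ∀ u → nbSum G f u ≡ nbSum G g u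
  nbSum-cong {f} {g} f≗g u = begin
    nbSum G f u            ≡⟨ nbSum≡∑ f u ⟩
    ∑ (restrictToN u f)    ≡⟨ sum-cong-≗ (λ i → cong (if adj G u i then_else 0) (f≗g i)) ⟩
    ∑ (restrictToN u g)    ≡⟨ nbSum≡∑ g u ⟨
    nbSum G g u            ∎
    where open ≡-Reasoning

  R2DF-resp-≗ : {f g : Vector ℕ n} → (∀ i → f i ≡ g i) → IsR2DF G f → IsR2DF G g
  R2DF-resp-≗ f≗g (bounded , dom) =
    (λ v → subst (_≤ 2) (f≗g v) (bounded v)) ,
    (λ v g[v]≡0 → subst (2 ≤_) (nbSum-cong f≗g v) (dom v (trans (f≗g v) g[v]≡0)))

  2dom⇒R2DF : {S : Subset n} → Is2DomSet G S → IsR2DF G (ind S)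
  2dom⇒R2DF {S} dom = (m≤n⇒m≤1+n ∘ ind≤1 S) , λ v S[v]≡0 → dom v λ v∈S →
    case trans (sym (ind-∈ v∈S)) S[v]≡0 of λ ()

  R2DF⇒2dom : {S : Subset n} → IsR2DF G (ind S) → Is2DomSet G S
  R2DF⇒2dom {S} (_ , dom) v v∉S = dom v (ind-∉ S v∉S)

module _ {n : ℕ} (G : Graph (suc n)) where

  ¬adj⇒nbSum≤∑removeAt : (f : Vector ℕ (suc n)) {v u : Fin (suc n)} → adj G v u ≡ false →
                         nbSum G f u ≤ ∑ (removeAt f v)
  ¬adj⇒nbSum≤∑removeAt f {v} {u} v≁u = begin
    nbSum G f u                                         ≡⟨ nbSum≡∑ G f u ⟩
    ∑ (restrictToN G u f)                               ≡⟨ sum-remove (restrictToN G u f) ⟩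
    restrictToN G u f v + ∑ (removeAt (restrictToN G u f) v)
      ≡⟨ cong (λ b → (if b then f v else 0) + ∑ (removeAt (restrictToN G u f) v)) (trans (symm G u v) v≁u) ⟩
    ∑ (removeAt (restrictToN G u f) v)                  ≤⟨ ∑-mono-≤ (restrictToN≤ G f u ∘ punchIn v) ⟩
    ∑ (removeAt f v)                                    ∎
    where open ≤-Reasoning

  R2DF⇒nonAdj≤ : {f : Vector ℕ (suc n)} → IsR2DF G f → {v : Fin (suc n)} →
                 ∑ (removeAt f v) ≤ 1 → ∀ u → nonAdj G v u ≤ f u
  R2DF⇒nonAdj≤ {f} (_ , dom) {v} rest≤1 u with adj G v u in v≁u
  ... | true  = z≤n
  ... | false with f u in f[u]
  ...   | suc _ = s≤s z≤n
  ...   | zero  = contradiction (≤-trans (dom u f[u]) (¬adj⇒nbSum≤∑removeAt f v≁u)) (<⇒≱ (s≤s rest≤1))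

  deg+nonNeighbours : (v : Fin (suc n)) → deg G v + suc (∑ (removeAt (nonAdj G v) v)) ≡ suc n
  deg+nonNeighbours v = begin
    deg G v + suc (∑ (removeAt (nonAdj G v) v))
      ≡⟨ cong (λ k → deg G v + (k + ∑ (removeAt (nonAdj G v) v))) (nonAdj-self G v) ⟨
    deg G v + (nonAdj G v v + ∑ (removeAt (nonAdj G v) v))   ≡⟨ cong (deg G v +_) (sum-remove (nonAdj G v)) ⟨
    deg G v + ∑ (nonAdj G v)                                 ≡⟨ deg+∑nonAdj G v ⟩
    suc n                                                    ∎
    where open ≡-Reasoning

  order≤deg+2 : {f : Vector ℕ (suc n)} → IsR2DF G f → {v : Fin (suc n)} →
                ∑ (removeAt f v) ≤ 1 → suc n ≤ deg G v + 2
  order≤deg+2 r {v} rest≤1 = subst (_≤ deg G v + 2) (deg+nonNeighbours v)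
    (+-monoʳ-≤ (deg G v) (s≤s (≤-trans (∑-mono-≤ (R2DF⇒nonAdj≤ r rest≤1 ∘ punchIn v)) rest≤1)))

  other-nonNeighbour : {v : Fin (suc n)} → deg G v + 2 ≤ suc n →
                       ∃ λ x → x ≢ v × adj G v x ≡ false
  other-nonNeighbour {v} deg+2≤order = punchIn v j , punchInᵢ≢i v j , nonAdj>0⇒¬adj G rest[j]>0
    where
    rest>0 : 0 < ∑ (removeAt (nonAdj G v) v)
    rest>0 = ≤-pred (+-cancelˡ-≤ (deg G v) 2 _
      (subst (deg G v + 2 ≤_) (sym (deg+nonNeighbours v)) deg+2≤order))
    j : Fin n
    j = proj₁ (∑-pos (removeAt (nonAdj G v) v) rest>0)
    rest[j]>0 : 0 < nonAdj G v (punchIn v j)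
    rest[j]>0 = proj₂ (∑-pos (removeAt (nonAdj G v) v) rest>0)

  maxDegreeVertex : ∃ λ v → deg G v ≡ Δ G
  maxDegreeVertex = let v , Δ≡deg = foldr-⊔-attained (deg G) in
    v , sym (trans (foldr-map-allFin _⊔_ 0 (deg G)) Δ≡deg)

  R2DF⇒positive : {f : Vector ℕ (suc n)} → IsR2DF G f → ∃ λ v → 1 ≤ f v
  R2DF⇒positive {f} (_ , dom) with f zero ≟ 0
  ... | no  f[0]≢0 = zero , n≢0⇒n>0 f[0]≢0
  ... | yes f[0]≡0 = ∑-pos f (≤-trans (s≤s z≤n) (≤-trans (dom zero f[0]≡0) (nbSum≤∑ G f zero)))

  light⇒order≤Δ+2 : LightR2DF G → suc n ≤ Δ G + 2
  light⇒order≤Δ+2 (f , r , ∑≤2) = let v , f[v]≥1 = R2DF⇒positive r in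
    ≤-trans (order≤deg+2 r (∑-removeAt≤ f f[v]≥1 ∑≤2)) (+-monoˡ-≤ 2 (deg≤Δ G v))

  light⇒degree : Δ G + 2 ≡ suc n → {f : Vector ℕ (suc n)} → IsR2DF G f → ∑ f ≤ 2 →
                 ∀ {v} → 1 ≤ f v → deg G v + 2 ≡ suc n
  light⇒degree Δ+2≡order {f} r ∑≤2 {v} f[v]≥1 = ≤-antisym
    (subst (deg G v + 2 ≤_) Δ+2≡order (+-monoˡ-≤ 2 (deg≤Δ G v)))
    (order≤deg+2 r (∑-removeAt≤ f f[v]≥1 ∑≤2))

  clique⇒¬light : Δ G + 2 ≡ suc n → DegNminus2Clique G → ¬ LightR2DF G
  clique⇒¬light Δ+2≡order clique (f , r , ∑≤2) with R2DF⇒positive r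
  ... | v , f[v]≥1 with other-nonNeighbour (≤-reflexive (light⇒degree Δ+2≡order r ∑≤2 f[v]≥1))
  ...   | x , x≢v , v≁x = case trans (sym v~x) v≁x of λ ()
    where
    f[x]≥1 : 1 ≤ f x
    f[x]≥1 = subst (_≤ f x) (¬adj⇒nonAdj≡1 G v≁x) (R2DF⇒nonAdj≤ r (∑-removeAt≤ f f[v]≥1 ∑≤2) x)
    v~x : Adj G v x
    v~x = clique v x (light⇒degree Δ+2≡order r ∑≤2 f[v]≥1) (light⇒degree Δ+2≡order r ∑≤2 f[x]≥1)
                 (x≢v ∘ sym)

  weight3⇒boolean : Δ G + 2 < suc n → {f : Vector ℕ (suc n)} → IsR2DF G f → ∑ f ≡ 3 →
                    ∀ v → f v ≤ 1
  weight3⇒boolean Δ+2<order {f} r ∑≡3 v with f v ≤? 1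
  ... | yes f[v]≤1 = f[v]≤1
  ... | no  f[v]≰1 = contradiction
    (≤-trans (order≤deg+2 r (∑-removeAt≤ f (≰⇒> f[v]≰1) (≤-reflexive ∑≡3))) (+-monoˡ-≤ 2 (deg≤Δ G v)))
    (<⇒≱ Δ+2<order)

  R2DF-with-Δ+∑≡order+1 : Σ[ f ∈ Vector ℕ (suc n) ] IsR2DF G f × Δ G + ∑ f ≡ suc (suc n)
  R2DF-with-Δ+∑≡order+1 with maxDegreeVertex
  ... | v , deg≡Δ = star G v , star-R2DF G v ,
    subst (λ d → d + ∑ (star G v) ≡ suc (suc n)) deg≡Δ (deg+∑star G v)

  ¬light⇒Δ+2≤order : ¬ LightR2DF G → Δ G + 2 ≤ suc n
  ¬light⇒Δ+2≤order ¬light with R2DF-with-Δ+∑≡order+1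
  ... | f , r , Δ+∑≡ = ≮⇒≥ λ order<Δ+2 →
    ¬light (f , r , +-cancelˡ-≤ (Δ G) _ 2 (subst (_≤ Δ G + 2) (sym Δ+∑≡) order<Δ+2))

  ¬light⇒3≤weight : ¬ LightR2DF G → ∀ f → IsR2DF G f → 3 ≤ weight f
  ¬light⇒3≤weight ¬light f r = subst (3 ≤_) (sym (weight≡∑ f)) (≰⇒> λ ∑≤2 → ¬light (f , r , ∑≤2))

  3≤weight⇒¬light : (∀ f → IsR2DF G f → 3 ≤ weight f) → ¬ LightR2DF G
  3≤weight⇒¬light minimal (f , r , ∑≤2) =
    <⇒≱ (s≤s ∑≤2) (subst (3 ≤_) (weight≡∑ f) (minimal f r))

  R2DomNumberIs3 : {f : Vector ℕ (suc n)} → IsR2DF G f → ∑ f ≡ 3 → ¬ LightR2DF G →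
                   R2DomNumberIs G 3
  R2DomNumberIs3 {f} r ∑≡3 ¬light = (f , r , trans (weight≡∑ f) ∑≡3) , ¬light⇒3≤weight ¬light

  ¬light⇒clique : ¬ LightR2DF G → DegNminus2Clique G
  ¬light⇒clique ¬light u v deg-u deg-v u≢v with adj G u v in u~v
  ... | true  = refl
  ... | false = contradiction (nonAdjacentPair⇒light G deg-u deg-v u≢v u~v) ¬light

  clique⇒R2DomNumberIs3 : Δ G + 2 ≡ suc n → DegNminus2Clique G → R2DomNumberIs G 3
  clique⇒R2DomNumberIs3 Δ+2≡order clique with R2DF-with-Δ+∑≡order+1
  ... | f , r , Δ+∑≡ = R2DomNumberIs3 r
    (+-cancelˡ-≡ (Δ G) _ 3 (trans Δ+∑≡ (sym (trans (+-suc (Δ G) 2) (cong suc Δ+2≡order)))))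
    (clique⇒¬light Δ+2≡order clique)

  R2DomNumberIs3⇒TwoDomNumberIs3 : Δ G + 2 < suc n → R2DomNumberIs G 3 → TwoDomNumberIs G 3
  R2DomNumberIs3⇒TwoDomNumberIs3 Δ+2<order ((f , r , weight≡3) , minimal) =
    (support f , dom , ∣support∣≡3) , λ S dom →
      subst (3 ≤_) (trans (weight≡∑ (ind S)) (∑-ind S)) (minimal (ind S) (2dom⇒R2DF G dom))
    where
    ∑≡3 : ∑ f ≡ 3
    ∑≡3 = trans (sym (weight≡∑ f)) weight≡3
    ind-support≗f : ∀ v → ind (support f) v ≡ f v
    ind-support≗f = ind-support f (weight3⇒boolean Δ+2<order r ∑≡3)
    dom : Is2DomSet G (support f)
    dom = R2DF⇒2dom G (R2DF-resp-≗ G (sym ∘ ind-support≗f) r)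
    ∣support∣≡3 : ∣ support f ∣ ≡ 3
    ∣support∣≡3 = trans (sym (∑-ind (support f))) (trans (sum-cong-≗ ind-support≗f) ∑≡3)

  TwoDomNumberIs3⇒R2DomNumberIs3 : Δ G + 2 < suc n → TwoDomNumberIs G 3 → R2DomNumberIs G 3
  TwoDomNumberIs3⇒R2DomNumberIs3 Δ+2<order ((S , dom , ∣S∣≡3) , _) =
    R2DomNumberIs3 (2dom⇒R2DF G dom) (trans (∑-ind S) ∣S∣≡3) (<⇒≱ Δ+2<order ∘ light⇒order≤Δ+2)

proposition2p2 : (n : ℕ) (G : Graph n) →
    R2DomNumberIs G 3 ⇔
      ((Δ G + 2 ≡ n × DegNminus2Clique G) ⊎ (Δ G + 2 < n × TwoDomNumberIs G 3))
proposition2p2 zero G = mk⇔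
  (λ (_ , minimal) → contradiction (minimal (λ ()) ((λ ()) , (λ ()))) λ ())
  λ { (inj₁ (() , _)) ; (inj₂ (() , _)) }
proposition2p2 (suc n) G = mk⇔ forward backward
  where
  Conditions = (Δ G + 2 ≡ suc n × DegNminus2Clique G) ⊎ (Δ G + 2 < suc n × TwoDomNumberIs G 3)

  forward : R2DomNumberIs G 3 → Conditions
  forward γ≡3 = by-cases (m≤n⇒m<n∨m≡n (¬light⇒Δ+2≤order G ¬light))
    where
    ¬light = 3≤weight⇒¬light G (proj₂ γ≡3)
    by-cases : Δ G + 2 < suc n ⊎ Δ G + 2 ≡ suc n → Conditions
    by-cases (inj₁ Δ+2<order) = inj₂ (Δ+2<order , R2DomNumberIs3⇒TwoDomNumberIs3 G Δ+2<order γ≡3)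
    by-cases (inj₂ Δ+2≡order) = inj₁ (Δ+2≡order , ¬light⇒clique G ¬light)

  backward : Conditions → R2DomNumberIs G 3
  backward (inj₁ (Δ+2≡order , clique)) = clique⇒R2DomNumberIs3 G Δ+2≡order clique
  backward (inj₂ (Δ+2<order , γ₂≡3))   = TwoDomNumberIs3⇒R2DomNumberIs3 G Δ+2<order γ₂≡3
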